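{- For every hypergraph $\mathcal{H}$ and positive integer $k$, the following are equivalent: (1) $\mathcal{H}$ is a Sperner hypergraph of dimension at most $k$ whose dual hypergraph $\mathcal{H}^d$ is conformal; (2) there exists a graph $G$ with $\tau_c^+(G)\le k$ such that $\mathcal{H}$ is the hypergraph (on vertex set $V(G)$) whose hyperedges are exactly the minimal clique transversals of $G$.
   Context: A hypergraph is a pair $\mathcal{H}=(V,E)$ with $V$ a finite nonempty set and $E$ a set of subsets of $V$ (hyperedges) such that every vertex lies in some hyperedge. It is Sperner if no hyperedge contains another; its dimension is the maximum size of a hyperedge. A transversal is a set of vertices meeting every hyperedge; minimal if no proper subset is a transversal. The dual $\mathcal{H}^d$ has vertex set $V$ and hyperedges the minimal transversals of $\mathcal{H}$. A hypergraph is conformal if for every set $U$ of vertices such that every pair of vertices of $U$ lies in a common hyperedge, $U$ is contained in some hyperedge. For a finite simple graph $G$, a clique transversal is a set of vertices intersecting every maximal clique; minimal if no proper subset is one; $\tau_c^+(G)$ is the maximum size of a minimal clique transversal. -}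

module Defs where

open import Data.Nat using (ℕ; suc; _≤_)
open import Data.Bool using (Bool; true; false)
open import Data.Fin using (Fin)
open import Data.Fin.Subset using (Subset; _∈_; _⊆_; _⊂_; ∣_∣)
open import Data.Product using (Σ; ∃; _×_; _,_)
open import Relation.Binary.PropositionalEquality using (_≡_; _≢_)
open import Relation.Nullary using (¬_)

-- A hypergraph on the (nonempty) vertex set Fin (suc m); written for general n.
record Hypergraph (n : ℕ) : Set where
  field
    edge   : Subset n → Bool
    covers : ∀ (v : Fin n) → ∃ λ (S : Subset n) → edge S ≡ true × v ∈ S
open Hypergraph public

module _ {n : ℕ} where

  IsEdge : Hypergraph n → Subset n → Set
  IsEdge H S = edge H S ≡ true

  Sperner : Hypergraph n → Set
  Sperner H = ∀ S T → IsEdge H S → IsEdge H T → S ⊆ T → S ≡ T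

  DimAtMost : Hypergraph n → ℕ → Set
  DimAtMost H k = ∀ S → IsEdge H S → ∣ S ∣ ≤ k

  Transversal : Hypergraph n → Subset n → Set
  Transversal H T = ∀ S → IsEdge H S → ∃ λ v → v ∈ S × v ∈ T

  MinimalTransversal : Hypergraph n → Subset n → Set
  MinimalTransversal H T = Transversal H T × (∀ T' → T' ⊂ T → ¬ Transversal H T')

  Conformal : (Subset n → Set) → Set
  Conformal E = ∀ (U : Subset n) →
    (∀ u v → u ∈ U → v ∈ U → ∃ λ S → E S × u ∈ S × v ∈ S) →
    ∃ λ S → E S × U ⊆ S

  -- the dual hypergraph H^d has vertex set Fin n and hyperedges the minimal transversals of H;
  -- we state conformality of H^d as conformality of its hyperedge family
  DualConformal : Hypergraph n → Set
  DualConformal H = Conformal (MinimalTransversal H)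

record Graph (n : ℕ) : Set where
  field
    adj     : Fin n → Fin n → Bool
    irrefl  : ∀ u → adj u u ≡ false
    sym     : ∀ u v → adj u v ≡ adj v u
open Graph public

module _ {n : ℕ} where

  Adj : Graph n → Fin n → Fin n → Set
  Adj G u v = adj G u v ≡ true

  Clique : Graph n → Subset n → Set
  Clique G C = ∀ u v → u ∈ C → v ∈ C → u ≢ v → Adj G u v

  MaximalClique : Graph n → Subset n → Set
  MaximalClique G C = Clique G C × (∀ D → C ⊂ D → ¬ Clique G D)

  CliqueTransversal : Graph n → Subset n → Set
  CliqueTransversal G T = ∀ C → MaximalClique G C → ∃ λ v → v ∈ C × v ∈ T

  MinimalCliqueTransversal : Graph n → Subset n → Set
  MinimalCliqueTransversal G T =
    CliqueTransversal G T × (∀ T' → T' ⊂ T → ¬ CliqueTransversal G T')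

  -- τ_c^+(G) ≤ k : every minimal clique transversal has size at most k
  UpperCliqueTransversalAtMost : Graph n → ℕ → Set
  UpperCliqueTransversalAtMost G k = ∀ T → MinimalCliqueTransversal G T → ∣ T ∣ ≤ k

{-# OPTIONS --safe #-}
-- A Sperner family E is the family of minimal transversals of its family of minimal
-- transversals. Maximal cliques of a graph form a conformal antichain, and conversely a
-- conformal antichain covering every vertex is the family of maximal cliques of its
-- two-section graph (u ~ v iff u ≠ v lie in a common member). So the edges of H are the
-- minimal clique transversals of some graph G exactly when H^d is such a family, i.e. when
-- H is Sperner and H^d is conformal; the dimension of H is then τ_c^+(G).
module Submission where

open import Defs
open import Data.Nat using (ℕ; suc; _≤_)
open import Data.Bool using (true; false; _≟_)
open import Data.Fin using (Fin) renaming (_≟_ to _≟ᶠ_)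
open import Data.Fin.Properties using (any?; all?)
open import Data.Fin.Subset using (Subset; _∈_; _∉_; _⊆_; _⊇_; _⊂_; _⊃_; ∁; _∪_; ⁅_⁆)
open import Data.Fin.Subset.Properties
  using (_∈?_; _⊆?_; _⊂?_; anySubset?; ⊆-refl; ⊆-trans; ⊆-antisym;
         x∉p⇒x∈∁p; x∈p⇒x∉∁p; x∈p∪q⁺; x∈p∪q⁻; x∈⁅x⁆; x∈⁅y⁆⇒x≡y)
open import Data.Fin.Subset.Induction using (⊂-wellFounded; ⊃-wellFounded)
open import Data.Product using (∃; _×_; _,_; proj₁; proj₂)
open import Data.Sum using (_⊎_; inj₁; inj₂)
open import Data.Empty using (⊥-elim)
open import Function using (flip)
open import Function.Bundles using (_⇔_; mk⇔; Equivalence)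
import Function.Properties.Equivalence as ⇔
open import Level using (0ℓ)
open import Induction.WellFounded using (WellFounded; Acc; acc)
open import Relation.Binary using (Rel)
open import Relation.Binary.PropositionalEquality using (_≡_; _≢_; refl; subst) renaming (sym to ≡-sym)
open import Relation.Nullary using (¬_; Dec; yes; no)
open import Relation.Nullary.Decidable
  using (_×-dec_; _→-dec_; ¬?; decidable-stable; isYes)
open import Relation.Unary using (Pred; Decidable)

module _ {n : ℕ} where

  ⊈⇒∃∉ : ∀ {p q : Subset n} → ¬ p ⊆ q → ∃ λ x → x ∈ p × x ∉ q
  ⊈⇒∃∉ {p} {q} p⊈q with any? (λ x → (x ∈? p) ×-dec ¬? (x ∈? q))
  ... | yes witness = witness
  ... | no none = ⊥-elim (p⊈q (λ {x} x∈p →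
          decidable-stable (x ∈? q) (λ x∉q → none (x , x∈p , x∉q))))

  ⊆⇒≡⊎⊂ : ∀ {p q : Subset n} → p ⊆ q → p ≡ q ⊎ p ⊂ q
  ⊆⇒≡⊎⊂ {p} {q} p⊆q with q ⊆? p
  ... | yes q⊆p = inj₁ (⊆-antisym p⊆q q⊆p)
  ... | no q⊈p = inj₂ (p⊆q , ⊈⇒∃∉ q⊈p)

  allSubsets? : ∀ {ℓ} {P : Pred (Subset n) ℓ} → Decidable P → Dec (∀ S → P S)
  allSubsets? P? with anySubset? (λ S → ¬? (P? S))
  ... | yes (S , ¬PS) = no (λ ∀P → ¬PS (∀P S))
  ... | no ∄¬P = yes (λ S → decidable-stable (P? S) (λ ¬PS → ∄¬P (S , ¬PS)))

  module Extremal {_<_ _≤_ : Rel (Subset n) 0ℓ}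
    (<-wellFounded : WellFounded _<_) (_<?_ : ∀ p q → Dec (p < q))
    (<⇒≤ : ∀ {p q} → p < q → p ≤ q) (≤-refl : ∀ {p} → p ≤ p)
    (≤-trans : ∀ {p q r} → p ≤ q → q ≤ r → p ≤ r) where

    extremal : ∀ {P : Pred (Subset n) 0ℓ} → Decidable P → ∀ S → P S →
               ∃ λ S′ → S′ ≤ S × P S′ × (∀ U → U < S′ → ¬ P U)
    extremal {P} P? S PS = search S PS (<-wellFounded S)
      where
      search : ∀ S → P S → Acc _<_ S → ∃ λ S′ → S′ ≤ S × P S′ × (∀ U → U < S′ → ¬ P U)
      search S PS (acc rec) with anySubset? (λ U → (U <? S) ×-dec P? U)
      ... | no none = S , ≤-refl , PS , λ U U<S PU → none (U , U<S , PU)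
      ... | yes (U , U<S , PU) with search U PU (rec U<S)
      ...   | S′ , S′≤U , PS′ , extremalS′ = S′ , ≤-trans S′≤U (<⇒≤ U<S) , PS′ , extremalS′

  minimal-⊆ : ∀ {P : Pred (Subset n) 0ℓ} → Decidable P → ∀ S → P S →
              ∃ λ S′ → S′ ⊆ S × P S′ × (∀ U → U ⊂ S′ → ¬ P U)
  minimal-⊆ = Extremal.extremal ⊂-wellFounded _⊂?_ proj₁ ⊆-refl ⊆-trans

  maximal-⊇ : ∀ {P : Pred (Subset n) 0ℓ} → Decidable P → ∀ S → P S →
              ∃ λ S′ → S′ ⊇ S × P S′ × (∀ U → U ⊃ S′ → ¬ P U)
  maximal-⊇ = Extremal.extremal ⊃-wellFounded (flip _⊂?_) proj₁ ⊆-refl (flip ⊆-trans)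

module _ {n : ℕ} where

  IsTransversal : Pred (Subset n) 0ℓ → Subset n → Set
  IsTransversal E T = ∀ S → E S → ∃ λ v → v ∈ S × v ∈ T

  IsMinimalTransversal : Pred (Subset n) 0ℓ → Subset n → Set
  IsMinimalTransversal E T = IsTransversal E T × (∀ T′ → T′ ⊂ T → ¬ IsTransversal E T′)

  IsAntichain : Pred (Subset n) 0ℓ → Set
  IsAntichain E = ∀ S T → E S → E T → S ⊆ T → S ≡ T

  CommonMember : Pred (Subset n) 0ℓ → Fin n → Fin n → Set
  CommonMember E u v = ∃ λ S → E S × u ∈ S × v ∈ S

  isTransversal? : ∀ {E} → Decidable E → Decidable (IsTransversal E)
  isTransversal? E? T = allSubsets? λ S → E? S →-dec any? λ v → (v ∈? S) ×-dec (v ∈? T)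

  isMinimalTransversal? : ∀ {E} → Decidable E → Decidable (IsMinimalTransversal E)
  isMinimalTransversal? E? T =
    isTransversal? E? T ×-dec allSubsets? λ T′ → (T′ ⊂? T) →-dec ¬? (isTransversal? E? T′)

  isMinimalTransversal-cong : ∀ {E F} → (∀ S → E S ⇔ F S) →
                              ∀ T → IsMinimalTransversal E T ⇔ IsMinimalTransversal F T
  isMinimalTransversal-cong E⇔F T = mk⇔ (transfer E⇔F) (transfer (λ S → ⇔.sym (E⇔F S)))
    where
    transfer : ∀ {E F} → (∀ S → E S ⇔ F S) →
               IsMinimalTransversal E T → IsMinimalTransversal F T
    transfer E⇔F (transversal , minimal) =
        (λ S FS → transversal S (Equivalence.from (E⇔F S) FS))
      , (λ T′ T′⊂T T′-transversal →
           minimal T′ T′⊂T (λ S ES → T′-transversal S (Equivalence.to (E⇔F S) ES)))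

  conformal-cong : ∀ {E F} → (∀ S → E S ⇔ F S) → Conformal E → Conformal F
  conformal-cong E⇔F conformal U pairwise
    with conformal U together
    where
    together : ∀ u v → u ∈ U → v ∈ U → CommonMember _ u v
    together u v u∈U v∈U with pairwise u v u∈U v∈U
    ... | S , FS , u∈S , v∈S = S , Equivalence.from (E⇔F S) FS , u∈S , v∈S
  ... | S , ES , U⊆S = S , Equivalence.to (E⇔F S) ES , U⊆S

  minimalTransversals-antichain : ∀ E → IsAntichain (IsMinimalTransversal E)
  minimalTransversals-antichain E S T (S-transversal , _) (_ , T-minimal) S⊆T with ⊆⇒≡⊎⊂ S⊆T
  ... | inj₁ S≡T = S≡T
  ... | inj₂ S⊂T = ⊥-elim (T-minimal S S⊂T S-transversal)

  module _ {E : Pred (Subset n) 0ℓ} (E? : Decidable E) where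

    minimalTransversal-⊆ : ∀ T → IsTransversal E T →
                           ∃ λ T′ → T′ ⊆ T × IsMinimalTransversal E T′
    minimalTransversal-⊆ = minimal-⊆ (isTransversal? E?)

    -- If A contains no member then ∁ A is a transversal, and a minimal one inside it misses A.
    transversal-of-minimalTransversals-⊇-member :
      ∀ A → IsTransversal (IsMinimalTransversal E) A → ∃ λ S → E S × S ⊆ A
    transversal-of-minimalTransversals-⊇-member A A-transversal
      with anySubset? (λ S → E? S ×-dec (S ⊆? A))
    ... | yes member = member
    ... | no ∄member with minimalTransversal-⊆ (∁ A) ∁A-transversal
      where
      ∁A-transversal : IsTransversal E (∁ A)
      ∁A-transversal S ES with ⊈⇒∃∉ (λ S⊆A → ∄member (S , ES , S⊆A))
      ... | x , x∈S , x∉A = x , x∈S , x∉p⇒x∈∁p x∉A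
    ...   | T , T⊆∁A , T-minimal with A-transversal T T-minimal
    ...     | v , v∈T , v∈A = ⊥-elim (x∈p⇒x∉∁p v∈A (T⊆∁A v∈T))

    member-isTransversal : ∀ S → E S → IsTransversal (IsMinimalTransversal E) S
    member-isTransversal S ES T (T-transversal , _) with T-transversal S ES
    ... | v , v∈S , v∈T = v , v∈T , v∈S

    module _ (antichain : IsAntichain E) where

      minimalTransversals-involutive :
        ∀ S → E S ⇔ IsMinimalTransversal (IsMinimalTransversal E) S
      minimalTransversals-involutive S = mk⇔ member⇒ ⇒member
        where
        member⇒ : E S → IsMinimalTransversal (IsMinimalTransversal E) S
        member⇒ ES = member-isTransversal S ES , λ S′ S′⊂S S′-transversal →
          let F , EF , F⊆S′ = transversal-of-minimalTransversals-⊇-member S′ S′-transversal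
              S′⊆S , x , x∈S , x∉S′ = S′⊂S
              F≡S = antichain F S EF ES (⊆-trans F⊆S′ S′⊆S)
          in x∉S′ (F⊆S′ (subst (x ∈_) (≡-sym F≡S) x∈S))

        ⇒member : IsMinimalTransversal (IsMinimalTransversal E) S → E S
        ⇒member (S-transversal , S-minimal)
          with transversal-of-minimalTransversals-⊇-member S S-transversal
        ... | F , EF , F⊆S with ⊆⇒≡⊎⊂ F⊆S
        ...   | inj₁ F≡S = subst E F≡S EF
        ...   | inj₂ F⊂S = ⊥-elim (S-minimal F F⊂S (member-isTransversal F EF))

      -- ∁ S ∪ ⁅ u ⁆ meets every member: S through u, the others outside S by the antichain property.
      minimalTransversal-∋ : ∀ S u → E S → u ∈ S → ∃ λ T → IsMinimalTransversal E T × u ∈ T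
      minimalTransversal-∋ S u ES u∈S with minimalTransversal-⊆ (∁ S ∪ ⁅ u ⁆) transversal
        where
        transversal : IsTransversal E (∁ S ∪ ⁅ u ⁆)
        transversal F EF with F ⊆? S
        ... | yes F⊆S = u , subst (u ∈_) (≡-sym (antichain F S EF ES F⊆S)) u∈S
                          , x∈p∪q⁺ (inj₂ (x∈⁅x⁆ u))
        ... | no F⊈S with ⊈⇒∃∉ F⊈S
        ...   | x , x∈F , x∉S = x , x∈F , x∈p∪q⁺ (inj₁ (x∉p⇒x∈∁p x∉S))
      ... | T , T⊆ , T-minimal with proj₁ T-minimal S ES
      ...   | v , v∈S , v∈T with x∈p∪q⁻ (∁ S) ⁅ u ⁆ (T⊆ v∈T)
      ...     | inj₁ v∈∁S = ⊥-elim (x∈p⇒x∉∁p v∈S v∈∁S)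
      ...     | inj₂ v∈⁅u⁆ = T , T-minimal , subst (_∈ T) (x∈⁅y⁆⇒x≡y u v∈⁅u⁆) v∈T

module _ {n : ℕ} (G : Graph n) where

  isClique? : Decidable (Clique G)
  isClique? C = all? λ u → all? λ v →
    (u ∈? C) →-dec (v ∈? C) →-dec ¬? (u ≟ᶠ v) →-dec (adj G u v ≟ true)

  isMaximalClique? : Decidable (MaximalClique G)
  isMaximalClique? C = isClique? C ×-dec allSubsets? λ D → (C ⊂? D) →-dec ¬? (isClique? D)

  maximalCliques-antichain : IsAntichain (MaximalClique G)
  maximalCliques-antichain C D (_ , C-maximal) (D-clique , _) C⊆D with ⊆⇒≡⊎⊂ C⊆D
  ... | inj₁ C≡D = C≡D
  ... | inj₂ C⊂D = ⊥-elim (C-maximal D C⊂D D-clique)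

  maximalCliques-conformal : Conformal (MaximalClique G)
  maximalCliques-conformal U pairwise with maximal-⊇ isClique? U U-clique
    where
    U-clique : Clique G U
    U-clique u v u∈U v∈U u≢v with pairwise u v u∈U v∈U
    ... | _ , (S-clique , _) , u∈S , v∈S = S-clique u v u∈S v∈S u≢v
  ... | D , U⊆D , D-clique , D-maximal = D , (D-clique , D-maximal) , U⊆D

module _ {n : ℕ} {E : Pred (Subset n) 0ℓ} (E? : Decidable E) where

  private
    Linked : Fin n → Fin n → Set
    Linked u v = u ≢ v × CommonMember E u v

    linked? : ∀ u v → Dec (Linked u v)
    linked? u v = ¬? (u ≟ᶠ v) ×-dec anySubset? λ S → E? S ×-dec ((u ∈? S) ×-dec (v ∈? S))

    linked-sym : ∀ {u v} → Linked u v → Linked v u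
    linked-sym (u≢v , S , ES , u∈S , v∈S) = (λ v≡u → u≢v (≡-sym v≡u)) , S , ES , v∈S , u∈S

  twoSection : Graph n
  twoSection = record
    { adj    = λ u v → isYes (linked? u v)
    ; irrefl = isYes-irrefl
    ; sym    = isYes-sym
    }
    where
    isYes-irrefl : ∀ u → isYes (linked? u u) ≡ false
    isYes-irrefl u with linked? u u
    ... | yes (u≢u , _) = ⊥-elim (u≢u refl)
    ... | no _ = refl

    isYes-sym : ∀ u v → isYes (linked? u v) ≡ isYes (linked? v u)
    isYes-sym u v with linked? u v | linked? v u
    ... | yes _ | yes _ = refl
    ... | no _ | no _ = refl
    ... | yes uv | no ¬vu = ⊥-elim (¬vu (linked-sym uv))
    ... | no ¬uv | yes vu = ⊥-elim (¬uv (linked-sym vu))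

  twoSection-adj⇔ : ∀ u v → Adj twoSection u v ⇔ (u ≢ v × CommonMember E u v)
  twoSection-adj⇔ u v with linked? u v
  ... | yes linked = mk⇔ (λ _ → linked) (λ _ → refl)
  ... | no ¬linked = mk⇔ (λ ()) (λ linked → ⊥-elim (¬linked linked))

  module _ (antichain : IsAntichain E) (conformal : Conformal E)
           (covering : ∀ v → ∃ λ S → E S × v ∈ S) where

    member-isClique : ∀ S → E S → Clique twoSection S
    member-isClique S ES u v u∈S v∈S u≢v =
      Equivalence.from (twoSection-adj⇔ u v) (u≢v , S , ES , u∈S , v∈S)

    clique-⊆-member : ∀ C → Clique twoSection C → ∃ λ S → E S × C ⊆ S
    clique-⊆-member C C-clique = conformal C pairwise
      where
      pairwise : ∀ u v → u ∈ C → v ∈ C → CommonMember E u v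
      pairwise u v u∈C v∈C with u ≟ᶠ v
      ... | yes refl = let S , ES , u∈S = covering u in S , ES , u∈S , u∈S
      ... | no u≢v = proj₂ (Equivalence.to (twoSection-adj⇔ u v) (C-clique u v u∈C v∈C u≢v))

    twoSection-maximalClique⇔member : ∀ C → MaximalClique twoSection C ⇔ E C
    twoSection-maximalClique⇔member C = mk⇔ maximal⇒member member⇒maximal
      where
      maximal⇒member : MaximalClique twoSection C → E C
      maximal⇒member (C-clique , C-maximal) with clique-⊆-member C C-clique
      ... | S , ES , C⊆S with ⊆⇒≡⊎⊂ C⊆S
      ...   | inj₁ C≡S = subst E (≡-sym C≡S) ES
      ...   | inj₂ C⊂S = ⊥-elim (C-maximal S C⊂S (member-isClique S ES))

      member⇒maximal : E C → MaximalClique twoSection C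
      member⇒maximal EC = member-isClique C EC , λ D C⊂D D-clique →
        let S , ES , D⊆S = clique-⊆-member D D-clique
            C⊆D , x , x∈D , x∉C = C⊂D
            C≡S = antichain C S EC ES (⊆-trans C⊆D D⊆S)
        in x∉C (subst (x ∈_) (≡-sym C≡S) (D⊆S x∈D))

module _ {n : ℕ} (H : Hypergraph n) where

  private
    isEdge? : Decidable (IsEdge H)
    isEdge? S = edge H S ≟ true

  sperner-dualConformal⇒minimalCliqueTransversals :
    Sperner H → DualConformal H →
    ∃ λ G → ∀ S → IsEdge H S ⇔ MinimalCliqueTransversal G S
  sperner-dualConformal⇒minimalCliqueTransversals sperner conformal =
    twoSection dual? , λ S →
      ⇔.trans (minimalTransversals-involutive isEdge? sperner S)
              (isMinimalTransversal-cong (λ T → ⇔.sym (dual⇔maximalClique T)) S)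
    where
    dual? : Decidable (MinimalTransversal H)
    dual? = isMinimalTransversal? isEdge?

    dual⇔maximalClique : ∀ T → MaximalClique (twoSection dual?) T ⇔ MinimalTransversal H T
    dual⇔maximalClique = twoSection-maximalClique⇔member dual?
      (minimalTransversals-antichain (IsEdge H)) conformal λ v →
        let S , ES , v∈S = covers H v in minimalTransversal-∋ isEdge? sperner S v ES v∈S

  minimalCliqueTransversals⇒sperner-dualConformal :
    ∀ G → (∀ S → IsEdge H S ⇔ MinimalCliqueTransversal G S) → Sperner H × DualConformal H
  minimalCliqueTransversals⇒sperner-dualConformal G edges = sperner , conformal
    where
    sperner : Sperner H
    sperner S T ES ET = minimalTransversals-antichain (MaximalClique G) S T
      (Equivalence.to (edges S) ES) (Equivalence.to (edges T) ET)

    conformal : DualConformal H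
    conformal = conformal-cong
      (λ T → ⇔.sym (⇔.trans (isMinimalTransversal-cong edges T)
        (⇔.sym (minimalTransversals-involutive (isMaximalClique? G) (maximalCliques-antichain G) T))))
      (maximalCliques-conformal G)

proposition5p1 : ∀ (m : ℕ) (H : Hypergraph (suc m)) (k : ℕ) → 1 ≤ k →
    ((Sperner H × DimAtMost H k × DualConformal H)
    ⇔ (∃ λ (G : Graph (suc m)) → UpperCliqueTransversalAtMost G k
    × (∀ (S : Subset (suc m)) → IsEdge H S ⇔ MinimalCliqueTransversal G S)))
proposition5p1 m H k _ = mk⇔ toGraph fromGraph
  where
  toGraph : Sperner H × DimAtMost H k × DualConformal H →
            ∃ λ G → UpperCliqueTransversalAtMost G k
                  × (∀ S → IsEdge H S ⇔ MinimalCliqueTransversal G S)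
  toGraph (sperner , dim , conformal) =
    let G , edges = sperner-dualConformal⇒minimalCliqueTransversals H sperner conformal
    in G , (λ T T-minimal → dim T (Equivalence.from (edges T) T-minimal)) , edges

  fromGraph : (∃ λ G → UpperCliqueTransversalAtMost G k
                     × (∀ S → IsEdge H S ⇔ MinimalCliqueTransversal G S)) →
              Sperner H × DimAtMost H k × DualConformal H
  fromGraph (G , bound , edges) =
    let sperner , conformal = minimalCliqueTransversals⇒sperner-dualConformal H G edges
    in sperner , (λ S ES → bound S (Equivalence.to (edges S) ES)) , conformal
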